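{- For all integers $i,d,k$ with $d\le i$ and $d\le k$, every incidence graph $G\in\mathscr{C}_d$, and every literal $x_\star$ of $G$: if $T$ is an $(i,d,k)$-obstruction-tree of $H:=G[x_\star]$, then $T$ is also an $(i,d,k)$-obstruction-tree of $G$, and $N^\dagger_G(T)=N^\dagger_H(T)$.
   Context: CNF formulas are identified with incidence graphs: bipartite graphs on variables and clauses, with a positive edge $\{x,c\}$ if $x_+\in c$ and a negative edge if $x_-\in c$ (no clause contains both). $G[x_\star]$ is the incidence graph of the formula obtained by setting $x$ to $\star\in\{+,-\}$: delete clauses containing $x_\star$ and delete the opposite literal of $x$ from the remaining clauses (it is an induced subgraph of $G$). The width of a clause is its number of variables; $\mathscr{C}_d$ is the class of formulas whose clauses all have width at most $d$; a $d$-clause has width exactly $d$. Let $\lambda_k=4\cdot 2^k$. For $G\in\mathscr{C}_d$, the $(i,d,k)$-obstruction-trees $T$ of $G$ ($i\ge d$), their element sets $V(T)$ (with clauses $\mathrm{cla}(T)$, variables $\mathrm{var}(T)$) and destroy-neighborhoods $N^\dagger_G(T)$ are defined inductively: (1) if $c$ is a $d$-clause of $G$ with variables $x_1,\dots,x_d$, then $T=\{c,x_1,\dots,x_d\}$ is a $(d,d,k)$-obstruction-tree, $V(T)=T$, $N^\dagger_G(T)=\{x_1,\dots,x_d\}$; (2) if $T_1,T_2$ are $(i,d,k)$-obstruction-trees of $G$ with $N^\dagger_G(T_1)\cap N^\dagger_G(T_2)=\emptyset$ and $P$ is a path in $G$ of length at most $\lambda_k$ connecting a vertex of $T_1$ and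 a vertex of $T_2$, then $T=(T_1,P,T_2)$ is an $(i+1,d,k)$-obstruction-tree with $V(T)=V(T_1)\cup V(P)\cup V(T_2)$ and $N^\dagger_G(T)=\mathrm{var}(T)\cup\{x:\ \exists c_1,c_2\in\mathrm{cla}(T)\text{ with }\{x,c_1\}\text{ positive and }\{x,c_2\}\text{ negative edges}\}$. -}

module Defs where

open import Data.Nat using (ℕ; suc; _*_; _^_; _≡ᵇ_)
open import Data.Bool using (Bool; true; false; not; if_then_else_; _∧_)
open import Data.Maybe using (Maybe; just; nothing; is-just)
open import Data.List using (List; []; _∷_; _++_; length; filterᵇ)
open import Data.List.Membership.Propositional using (_∈_)
open import Data.List.Relation.Unary.All using (All)
open import Data.List.Relation.Unary.Linked using (Linked)
open import Data.List.Relation.Unary.Unique.Propositional using (Unique)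
open import Data.Product using (Σ; _×_; ∃-syntax)
open import Data.Sum using (_⊎_)
open import Data.Empty using (⊥)
open import Relation.Binary.PropositionalEquality using (_≡_)
open import Function.Bundles using (_⇔_)

data Sign : Set where
  pos neg : Sign

_≟ˢ_ : Sign → Sign → Bool
pos ≟ˢ pos = true
neg ≟ˢ neg = true
_   ≟ˢ _   = false

-- Variables and clauses are named by natural numbers; the two sides are
-- kept apart by the Vertex tags below.  edge x c = just s means that
-- the literal x_s occurs in clause c (so no clause contains both x_+ and x_-).

record CNF : Set where
  field
    vars : List ℕ
    clas : List ℕ
    edge : ℕ → ℕ → Maybe Sign
open CNF public

record WF (G : CNF) : Set where
  field
    vars-unique : Unique (vars G)
    clas-unique : Unique (clas G)
    edge-present : ∀ x c s → edge G x c ≡ just s → (x ∈ vars G) × (c ∈ clas G)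

data Vertex : Set where
  var : ℕ → Vertex
  cla : ℕ → Vertex

InG : CNF → Vertex → Set
InG G (var x) = x ∈ vars G
InG G (cla c) = c ∈ clas G

Adj : CNF → Vertex → Vertex → Set
Adj G (var x) (var y) = ⊥
Adj G (var x) (cla c) = Σ Sign λ s → edge G x c ≡ just s
Adj G (cla c) (var x) = Σ Sign λ s → edge G x c ≡ just s
Adj G (cla c) (cla e) = ⊥

varsOf : CNF → ℕ → List ℕ
varsOf G c = filterᵇ (λ y → is-just (edge G y c)) (vars G)

width : CNF → ℕ → ℕ
width G c = length (varsOf G c)

InC : ℕ → CNF → Set
InC d G = ∀ c → c ∈ clas G → width G c Data.Nat.≤ d

-- G[x_s]: delete x, delete the clauses containing x_s; induced subgraph
containsLit : CNF → ℕ → Sign → ℕ → Bool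
containsLit G x s c with edge G x c
... | just t  = t ≟ˢ s
... | nothing = false

setLit : CNF → ℕ → Sign → CNF
setLit G x s = record
  { vars = filterᵇ (λ y → not (y ≡ᵇ x)) (vars G)
  ; clas = filterᵇ (λ c → not (containsLit G x s c)) (clas G)
  ; edge = λ y c → if (y ≡ᵇ x) then nothing
                   else if containsLit G x s c then nothing
                   else edge G y c
  }

λₖ : ℕ → ℕ
λₖ k = 4 * 2 ^ k

endOf : Vertex → List Vertex → Vertex
endOf u []       = u
endOf u (v ∷ vs) = endOf v vs

-- u ∷ vs is a (simple) path of G; its length is length vs
IsPath : CNF → Vertex → List Vertex → Set
IsPath G u vs = All (InG G) (u ∷ vs) × Unique (u ∷ vs) × Linked (Adj G) (u ∷ vs)

data Tree : Set where
  leaf : (c : ℕ) → (xs : List ℕ) → Tree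
  node : Tree → Vertex → List Vertex → Tree → Tree

V : Tree → List Vertex
V (leaf c xs)        = cla c ∷ Data.List.map var xs
V (node T₁ u vs T₂)  = V T₁ ++ (u ∷ vs) ++ V T₂

InN† : CNF → Tree → ℕ → Set
InN† G (leaf c xs) y = y ∈ xs
InN† G T@(node _ _ _ _) y =
  (var y ∈ V T) ⊎
  (∃[ c₁ ] ∃[ c₂ ] (cla c₁ ∈ V T) × (cla c₂ ∈ V T) ×
     (edge G y c₁ ≡ just pos) × (edge G y c₂ ≡ just neg))

data IsOT (G : CNF) (d k : ℕ) : ℕ → Tree → Set where
  leaf : ∀ {c xs} →
    c ∈ clas G → width G c ≡ d →
    (∀ y → (y ∈ xs) ⇔ (y ∈ varsOf G c)) →
    IsOT G d k d (leaf c xs)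
  node : ∀ {i T₁ u vs T₂} →
    IsOT G d k i T₁ → IsOT G d k i T₂ →
    (∀ y → InN† G T₁ y → InN† G T₂ y → ⊥) →
    IsPath G u vs → length vs Data.Nat.≤ λₖ k →
    u ∈ V T₁ → endOf u vs ∈ V T₂ →
    IsOT G d k (suc i) (node T₁ u vs T₂)

{-# OPTIONS --safe #-}
-- G[x_s] is an induced subgraph of G, so its vertices, edges and paths are
-- those of G.  A d-clause of G[x_s] has lost no variable, since every clause
-- of G has width at most d; so it is a d-clause of G with the same variables.
-- No clause of G[x_s] contains x_s, so x never has both a positive and a
-- negative edge into clauses of T, while every other variable has the same
-- edges in G and G[x_s]; hence N†_G(T) = N†_{G[x_s]}(T).
module Submission where

open import Defs
open import Level using (Level)
open import Data.Nat using (ℕ; _≤_; _≡ᵇ_; _≟_)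
open import Data.Nat.Properties using (≤-antisym; ≡ᵇ⇒≡; ≡⇒≡ᵇ)
open import Data.Bool using (Bool; true; false; not; T; T?)
open import Data.Bool.Properties using (T-≡; T-not-≡)
open import Data.Maybe using (just; is-just)
open import Data.List using (List; []; _∷_; filterᵇ; length)
open import Data.List.Properties using (length-filter; filter-complete)
open import Data.List.Membership.Propositional using (_∈_)
open import Data.List.Membership.Propositional.Properties using (∈-map⁻; ∈-++⁻; ∈-filter⁻)
open import Data.List.Relation.Unary.Any using (here; there)
open import Data.List.Relation.Unary.All as All using ()
open import Data.List.Relation.Unary.Linked as Linked using ()
open import Data.Product using (_×_; _,_; proj₁; proj₂)
open import Data.Sum using (_⊎_; inj₁; inj₂)
open import Relation.Nullary using (yes; no; contradiction)
open import Relation.Binary.PropositionalEquality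
open import Function.Base using (id)
open import Function.Bundles using (_⇔_; mk⇔; Equivalence)
open Equivalence using (to; from)

private variable
  a : Level
  A : Set a

filterᵇ-exchange : (p q r : A → Bool) → (∀ w → T (q w) → r w ≡ p w) →
  ∀ ws → filterᵇ r (filterᵇ q ws) ≡ filterᵇ q (filterᵇ p ws)
filterᵇ-exchange p q r r≗p [] = refl
filterᵇ-exchange p q r r≗p (w ∷ ws) with q w in qw | p w in pw
... | true  | true  rewrite r≗p w (from T-≡ qw) | pw | qw =
  cong (w ∷_) (filterᵇ-exchange p q r r≗p ws)
... | true  | false rewrite r≗p w (from T-≡ qw) | pw = filterᵇ-exchange p q r r≗p ws
... | false | true  rewrite qw = filterᵇ-exchange p q r r≗p ws
... | false | false = filterᵇ-exchange p q r r≗p ws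

filterᵇ-length-complete : (p : A → Bool) {ws : List A} →
  length ws ≤ length (filterᵇ p ws) → filterᵇ p ws ≡ ws
filterᵇ-length-complete p {ws} ws≤ =
  filter-complete (λ w → T? (p w)) (≤-antisym (length-filter _ ws) ws≤)

T-not-≡ᵇ⇒≢ : ∀ {m n} → T (not (m ≡ᵇ n)) → m ≢ n
T-not-≡ᵇ⇒≢ {m} m≢n refl = subst T (to T-not-≡ m≢n) (≡⇒≡ᵇ m m refl)

containsLit-edge : ∀ G x s {c} → edge G x c ≡ just s → containsLit G x s c ≡ true
containsLit-edge G x s {c} e with edge G x c
containsLit-edge G x pos refl | just .pos = refl
containsLit-edge G x neg refl | just .neg = refl

V-inG : ∀ {G d k i T v} → IsOT G d k i T → v ∈ V T → InG G v
V-inG (leaf c∈G _ _) (here refl) = c∈G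
V-inG {G} {T = leaf c xs} (leaf _ _ xs≈) (there v∈) with ∈-map⁻ var v∈
... | y , y∈xs , refl = proj₁ (∈-filter⁻ _ {xs = vars G} (to (xs≈ y) y∈xs))
V-inG {T = node T₁ u vs T₂} (node o₁ o₂ _ (path∈G , _) _ _ _) v∈ with ∈-++⁻ (V T₁) v∈
... | inj₁ v∈T₁ = V-inG o₁ v∈T₁
... | inj₂ v∈rest with ∈-++⁻ (u ∷ vs) v∈rest
...   | inj₁ v∈P  = All.lookup path∈G v∈P
...   | inj₂ v∈T₂ = V-inG o₂ v∈T₂

polarities-meet-containsLit : ∀ G x s {c₁ c₂} →
  edge G x c₁ ≡ just pos → edge G x c₂ ≡ just neg →
  containsLit G x s c₁ ≡ true ⊎ containsLit G x s c₂ ≡ true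
polarities-meet-containsLit G x pos e₁ e₂ = inj₁ (containsLit-edge G x pos e₁)
polarities-meet-containsLit G x neg e₁ e₂ = inj₂ (containsLit-edge G x neg e₂)

module SetLit (G : CNF) (x : ℕ) (s : Sign) where

  H : CNF
  H = setLit G x s

  edge-setLit : ∀ {y c} → containsLit G x s c ≡ false → y ≢ x →
    edge H y c ≡ edge G y c
  edge-setLit {y} c∌xs y≢x with y ≡ᵇ x in y≟x
  ... | true  = contradiction (≡ᵇ⇒≡ y x (from T-≡ y≟x)) y≢x
  ... | false rewrite c∌xs = refl

  edge-setLit⁻ : ∀ {y c t} → edge H y c ≡ just t → edge G y c ≡ just t
  edge-setLit⁻ {y} {c} e with y ≡ᵇ x | containsLit G x s c
  ... | false | false = e

  clas-setLit : ∀ {c} → c ∈ clas H → c ∈ clas G × containsLit G x s c ≡ false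
  clas-setLit c∈H with ∈-filter⁻ _ {xs = clas G} c∈H
  ... | c∈G , c∌xs = c∈G , to T-not-≡ c∌xs

  vars-setLit : ∀ {y} → y ∈ vars H → y ∈ vars G
  vars-setLit y∈H = proj₁ (∈-filter⁻ _ {xs = vars G} y∈H)

  InG-setLit : ∀ {v} → InG H v → InG G v
  InG-setLit {var y} = vars-setLit
  InG-setLit {cla c} c∈H = proj₁ (clas-setLit c∈H)

  Adj-setLit : ∀ {u v} → Adj H u v → Adj G u v
  Adj-setLit {var y} {cla c} (t , e) = t , edge-setLit⁻ e
  Adj-setLit {cla c} {var y} (t , e) = t , edge-setLit⁻ e

  IsPath-setLit : ∀ {u vs} → IsPath H u vs → IsPath G u vs
  IsPath-setLit (in-H , unique , linked) =
    All.map InG-setLit in-H , unique , Linked.map Adj-setLit linked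

  varsOf-setLit : ∀ {c} → containsLit G x s c ≡ false →
    varsOf H c ≡ filterᵇ (λ y → not (y ≡ᵇ x)) (varsOf G c)
  varsOf-setLit {c} c∌xs =
    filterᵇ-exchange (λ y → is-just (edge G y c)) (λ y → not (y ≡ᵇ x))
      (λ y → is-just (edge H y c))
      (λ y y≢x → cong is-just (edge-setLit c∌xs (T-not-≡ᵇ⇒≢ y≢x)))
      (vars G)

  varsOf-setLit-unshrunk : ∀ {c} → containsLit G x s c ≡ false →
    width G c ≤ width H c → varsOf H c ≡ varsOf G c
  varsOf-setLit-unshrunk {c} c∌xs wG≤wH =
    trans (varsOf-setLit c∌xs)
      (filterᵇ-length-complete _
        (subst (λ vs → width G c ≤ length vs) (varsOf-setLit c∌xs) wG≤wH))

  N†-setLit : ∀ T → (∀ {c} → cla c ∈ V T → c ∈ clas H) →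
    ∀ y → InN† G T y ⇔ InN† H T y
  N†-setLit (leaf c xs) _ y = mk⇔ id id
  N†-setLit T@(node _ _ _ _) clas-T⊆H y = mk⇔ toH toG
    where
      c∌xs : ∀ {c} → cla c ∈ V T → containsLit G x s c ≡ false
      c∌xs c∈T = proj₂ (clas-setLit (clas-T⊆H c∈T))

      toG : InN† H T y → InN† G T y
      toG (inj₁ y∈T) = inj₁ y∈T
      toG (inj₂ (c₁ , c₂ , c₁∈T , c₂∈T , e₁ , e₂)) =
        inj₂ (c₁ , c₂ , c₁∈T , c₂∈T , edge-setLit⁻ e₁ , edge-setLit⁻ e₂)

      toH : InN† G T y → InN† H T y
      toH (inj₁ y∈T) = inj₁ y∈T
      toH (inj₂ (c₁ , c₂ , c₁∈T , c₂∈T , e₁ , e₂)) with y ≟ x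
      ... | no y≢x = inj₂ (c₁ , c₂ , c₁∈T , c₂∈T ,
                           trans (edge-setLit (c∌xs c₁∈T) y≢x) e₁ ,
                           trans (edge-setLit (c∌xs c₂∈T) y≢x) e₂)
      ... | yes refl with polarities-meet-containsLit G x s e₁ e₂
      ...   | inj₁ c₁∋xs = contradiction (trans (sym c₁∋xs) (c∌xs c₁∈T)) λ ()
      ...   | inj₂ c₂∋xs = contradiction (trans (sym c₂∋xs) (c∌xs c₂∈T)) λ ()

  IsOT-setLit : ∀ {d k i T} → InC d G → IsOT H d k i T → IsOT G d k i T
  IsOT-setLit inC (leaf {c} c∈H wH≡d xs≈) with clas-setLit c∈H
  ... | c∈G , c∌xs =
    leaf c∈G (trans (cong length (sym same)) wH≡d)
      (λ y → subst (λ vs → (y ∈ _) ⇔ (y ∈ vs)) same (xs≈ y))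
    where
      same : varsOf H c ≡ varsOf G c
      same = varsOf-setLit-unshrunk c∌xs (subst (width G c ≤_) (sym wH≡d) (inC c c∈G))
  IsOT-setLit inC (node {T₁ = T₁} {T₂ = T₂} o₁ o₂ disjoint path length≤ u∈T₁ end∈T₂) =
    node (IsOT-setLit inC o₁) (IsOT-setLit inC o₂)
      (λ y y∈N₁ y∈N₂ → disjoint y (to (N†-setLit T₁ (V-inG o₁) y) y∈N₁)
                                  (to (N†-setLit T₂ (V-inG o₂) y) y∈N₂))
      (IsPath-setLit path) length≤ u∈T₁ end∈T₂

proposition5p8 : (i d k : ℕ) → d ≤ i → d ≤ k →
    (G : CNF) → WF G → InC d G →
    (x : ℕ) → x ∈ vars G → (s : Sign) →
    (T : Tree) → IsOT (setLit G x s) d k i T →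
    IsOT G d k i T × (∀ y → InN† G T y ⇔ InN† (setLit G x s) T y)
proposition5p8 i d k _ _ G _ inC x _ s T o = IsOT-setLit inC o , N†-setLit T (V-inG o)
  where open SetLit G x s
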